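{- Let $(X,\Pi,\mathcal{B})$ be a group divisible design of strong dimension $d$. Let $\infty\notin X$, $X^*=X\cup\{\infty\}$ and $\mathcal{B}^*=\mathcal{B}\cup\{G\cup\{\infty\} : G\in \Pi\}$. Then the linear space (PBD) $(X^*,\mathcal{B}^*)$ has dimension at least $d$.
   Context: A group divisible design (GDD) is a triple $(X,\Pi,\mathcal{B})$ where $X$ is a finite set of points, $\Pi$ is a partition of $X$ into groups, and $\mathcal{B}$ is a set of subsets of $X$ (blocks, each of size at least 2) such that a group and a block meet in at most one point, and every pair of points from distinct groups lies in exactly one block. A strong subspace of a GDD is a subset $X'\subseteq X$ such that every group is either contained in or disjoint from $X'$, and every block containing at least two points of $X'$ is contained in $X'$; it is proper if it is disjoint from at least one group. The strong dimension of a GDD is the maximum integer $d$ such that every set of $d$ points is contained in a proper strong subspace. For a linear space (PBD) $(Y,\mathcal{C})$, i.e. a set with blocks such that any two distinct points lie in exactly one block, a subspace is a subset $Y'$ such that every block meeting $Y'$ in at least two points is contained in $Y'$; it is proper if $Y'\ne Y$; the subspace generated by a set is the intersection of all subspaces containing it; and the dimension is the maximum $d$ such that every set of $d$ points generates a proper subspace. -}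

module Defs where

open import Data.Nat using (ℕ; suc; _≤_)
open import Data.Fin using (Fin)
open import Data.Fin.Subset using (Subset; _∈_; _∉_; _⊆_; ∣_∣; inside; outside)
open import Data.List using (List; length; map; _++_)
import Data.List.Membership.Propositional as LM
open import Data.List.Relation.Unary.All using (All)
open import Data.Product using (Σ; _×_; ∃)
open import Data.Sum using (_⊎_)
open import Data.Vec using (_∷_)
open import Relation.Binary.PropositionalEquality using (_≡_; _≢_)
open import Relation.Nullary using (¬_)

-- Throughout, a finite point set of size n is Fin n, a subset is a
-- Data.Fin.Subset (characteristic vector), and a (multi)set of blocks or
-- groups is a List of subsets (duplicates are harmless: uniqueness of the
-- block through a pair is stated up to equality of subsets).

_∈ₗ_ : ∀ {n} → Subset n → List (Subset n) → Set
B ∈ₗ 𝓑 = B LM.∈ 𝓑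

Disjoint : ∀ {n} → Subset n → Subset n → Set
Disjoint {n} A B = (x : Fin n) → x ∈ A → x ∈ B → Data.Empty.⊥
  where import Data.Empty

SameGroup : ∀ {n} → List (Subset n) → Fin n → Fin n → Set
SameGroup Π x y = Σ _ λ G → G ∈ₗ Π × x ∈ G × y ∈ G

record IsGDD (n : ℕ) (Π 𝓑 : List (Subset n)) : Set where
  field
    groups-nonempty : ∀ G → G ∈ₗ Π → ∃ λ x → x ∈ G
    groups-cover    : ∀ (x : Fin n) → Σ _ λ G → G ∈ₗ Π × x ∈ G
    groups-disjoint : ∀ G G' (x : Fin n) → G ∈ₗ Π → G' ∈ₗ Π →
                      x ∈ G → x ∈ G' → G ≡ G'
    block-size      : ∀ B → B ∈ₗ 𝓑 → 2 ≤ ∣ B ∣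
    group-block     : ∀ G B (x y : Fin n) → G ∈ₗ Π → B ∈ₗ 𝓑 →
                      x ∈ G → y ∈ G → x ∈ B → y ∈ B → x ≡ y
    pair-exists     : ∀ (x y : Fin n) → ¬ SameGroup Π x y →
                      Σ _ λ B → B ∈ₗ 𝓑 × x ∈ B × y ∈ B
    pair-unique     : ∀ (x y : Fin n) → ¬ SameGroup Π x y → ∀ B B' →
                      B ∈ₗ 𝓑 → B' ∈ₗ 𝓑 → x ∈ B → y ∈ B → x ∈ B' → y ∈ B' →
                      B ≡ B'

IsStrongSubspace : ∀ {n} → List (Subset n) → List (Subset n) → Subset n → Set
IsStrongSubspace {n} Π 𝓑 S =
  (∀ G → G ∈ₗ Π → G ⊆ S ⊎ Disjoint G S) ×
  (∀ B → B ∈ₗ 𝓑 → ∀ (x y : Fin n) → x ≢ y → x ∈ B → y ∈ B → x ∈ S → y ∈ S →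
     B ⊆ S)

IsProperStrong : ∀ {n} → List (Subset n) → Subset n → Set
IsProperStrong Π S = Σ _ λ G → G ∈ₗ Π × Disjoint G S

StrongDimProp : ∀ {n} → List (Subset n) → List (Subset n) → ℕ → Set
StrongDimProp {n} Π 𝓑 d =
  ∀ (xs : List (Fin n)) → length xs ≤ d →
    Σ (Subset n) λ S → IsStrongSubspace Π 𝓑 S × IsProperStrong Π S ×
                       All (_∈ S) xs

HasStrongDimension : ∀ {n} → List (Subset n) → List (Subset n) → ℕ → Set
HasStrongDimension Π 𝓑 d =
  StrongDimProp Π 𝓑 d × (∀ d' → StrongDimProp Π 𝓑 d' → d' ≤ d)

IsSubspace : ∀ {m} → List (Subset m) → Subset m → Set
IsSubspace {m} 𝓒 S =
  ∀ C → C ∈ₗ 𝓒 → ∀ (x y : Fin m) → x ≢ y → x ∈ C → y ∈ C → x ∈ S → y ∈ S →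
    C ⊆ S

InGenerated : ∀ {m} → List (Subset m) → List (Fin m) → Fin m → Set
InGenerated 𝓒 xs y = ∀ S → IsSubspace 𝓒 S → All (_∈ S) xs → y ∈ S

GeneratesProper : ∀ {m} → List (Subset m) → List (Fin m) → Set
GeneratesProper {m} 𝓒 xs = ¬ (∀ (y : Fin m) → InGenerated 𝓒 xs y)

DimProp : ∀ {m} → List (Subset m) → ℕ → Set
DimProp {m} 𝓒 d = ∀ (xs : List (Fin m)) → length xs ≤ d → GeneratesProper 𝓒 xs

HasDimension : ∀ {m} → List (Subset m) → ℕ → Set
HasDimension 𝓒 D = DimProp 𝓒 D × (∀ d' → DimProp 𝓒 d' → d' ≤ D)

-- The extension X* = X ∪ {∞}: points Fin (suc n), ∞ = zero, x ↦ suc x.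
-- B* = {B : B ∈ 𝓑} ∪ {G ∪ {∞} : G ∈ Π}.

extendBlocks : ∀ {n} → List (Subset n) → List (Subset n) → List (Subset (suc n))
extendBlocks Π 𝓑 = map (outside ∷_) 𝓑 ++ map (inside ∷_) Π

module Submission where

-- A proper strong subspace S of the GDD yields the subspace S ∪ {∞} of the
-- linear space: blocks of 𝓑 meeting S twice lie in S, and a line G ∪ {∞}
-- meeting S ∪ {∞} twice meets S, so G ⊆ S.  It is proper because it misses
-- every point of a group disjoint from S.  Hence any d points of X*, after
-- discarding ∞, lie in a proper subspace, and the dimension of X* is ≥ d.

open import Defs
open import Data.Nat using (ℕ; _≤_; suc; s≤s; z≤n)
open import Data.Nat.Properties using (≤-trans; m≤n⇒m≤1+n)
open import Data.Fin using (Fin; zero; suc)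
open import Data.Fin.Subset using (Subset; _∈_; _⊆_; inside; outside)
open import Data.List using (List; []; _∷_; length; map)
open import Data.List.Relation.Unary.All using (All; []; _∷_)
open import Data.List.Membership.Propositional.Properties using (∈-map⁻; ∈-++⁻)
open import Data.Vec using (_∷_; here; there)
open import Data.Product using (_,_; proj₁; proj₂)
open import Data.Sum using (inj₁; inj₂)
open import Data.Empty using (⊥; ⊥-elim)
open import Relation.Binary.PropositionalEquality using (refl; _≢_)

dropZeros : ∀ {n} → List (Fin (suc n)) → List (Fin n)
dropZeros [] = []
dropZeros (zero ∷ xs) = dropZeros xs
dropZeros (suc x ∷ xs) = x ∷ dropZeros xs

length-dropZeros : ∀ {n} (xs : List (Fin (suc n))) →
                   length (dropZeros xs) ≤ length xs
length-dropZeros [] = z≤n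
length-dropZeros (zero ∷ xs) = m≤n⇒m≤1+n (length-dropZeros xs)
length-dropZeros (suc x ∷ xs) = s≤s (length-dropZeros xs)

All-∈-inside∷ : ∀ {n} {S : Subset n} (xs : List (Fin (suc n))) →
                All (_∈ S) (dropZeros xs) → All (_∈ (inside ∷ S)) xs
All-∈-inside∷ [] _ = []
All-∈-inside∷ (zero ∷ xs) ∈S = here ∷ All-∈-inside∷ xs ∈S
All-∈-inside∷ (suc x ∷ xs) (x∈S ∷ ∈S) = there x∈S ∷ All-∈-inside∷ xs ∈S

ClosedUnder : ∀ {m} → Subset m → Subset m → Set
ClosedUnder {m} S C =
  ∀ (x y : Fin m) → x ≢ y → x ∈ C → y ∈ C → x ∈ S → y ∈ S → C ⊆ S

module _ {n : ℕ} {Π 𝓑 : List (Subset n)} {S : Subset n}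
         (strong : IsStrongSubspace Π 𝓑 S) where

  closedUnder-outside∷block : ∀ {B} → B ∈ₗ 𝓑 →
                              ClosedUnder (inside ∷ S) (outside ∷ B)
  closedUnder-outside∷block B∈𝓑 (suc x) (suc y) x≢y
    (there x∈B) (there y∈B) (there x∈S) (there y∈S) {suc z} (there z∈B) =
    there (proj₂ strong _ B∈𝓑 x y (λ { refl → x≢y refl }) x∈B y∈B x∈S y∈S z∈B)

  -- Two distinct points of G ∪ {∞} include one point of G, so G meets S.
  closedUnder-inside∷group : ∀ {G} → G ∈ₗ Π →
                             ClosedUnder (inside ∷ S) (inside ∷ G)
  closedUnder-inside∷group {G} G∈Π x y x≢y x∈G y∈G x∈S y∈S
    with proj₁ strong G G∈Π
  ... | inj₁ G⊆S = λ { here → here ; (there z∈G) → there (G⊆S z∈G) }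
  ... | inj₂ G∩S=∅ = ⊥-elim (meets x y x≢y x∈G y∈G x∈S y∈S)
    where
      meets : ∀ (x y : Fin (suc n)) → x ≢ y → x ∈ (inside ∷ G) →
              y ∈ (inside ∷ G) → x ∈ (inside ∷ S) → y ∈ (inside ∷ S) →
              ⊥
      meets (suc x) _ _ (there x∈G) _ (there x∈S) _ = G∩S=∅ x x∈G x∈S
      meets zero (suc y) _ _ (there y∈G) _ (there y∈S) = G∩S=∅ y y∈G y∈S
      meets zero zero x≢y _ _ _ _ = x≢y refl

  isSubspace-inside∷ : IsSubspace (extendBlocks Π 𝓑) (inside ∷ S)
  isSubspace-inside∷ C C∈𝓑* with ∈-++⁻ (map (outside ∷_) 𝓑) C∈𝓑*
  ... | inj₁ C∈𝓑 with ∈-map⁻ (outside ∷_) C∈𝓑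
  ...   | _ , B∈𝓑 , refl = closedUnder-outside∷block B∈𝓑
  isSubspace-inside∷ C C∈𝓑* | inj₂ C∈Π with ∈-map⁻ (inside ∷_) C∈Π
  ...   | _ , G∈Π , refl = closedUnder-inside∷group G∈Π

strongDimProp⇒dimProp : ∀ {n} {Π 𝓑 : List (Subset n)} {d : ℕ} → IsGDD n Π 𝓑 →
                        StrongDimProp Π 𝓑 d → DimProp (extendBlocks Π 𝓑) d
strongDimProp⇒dimProp gdd strongDim xs |xs|≤d generatesAll
  with strongDim (dropZeros xs) (≤-trans (length-dropZeros xs) |xs|≤d)
... | S , strong , (G , G∈Π , G∩S=∅) , xs⊆S
  with IsGDD.groups-nonempty gdd G G∈Π
... | x , x∈G
  with generatesAll (suc x) (inside ∷ S) (isSubspace-inside∷ strong)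
                    (All-∈-inside∷ xs xs⊆S)
... | there x∈S = G∩S=∅ x x∈G x∈S

lemma2p6 : (n : ℕ) (Π 𝓑 : List (Subset n)) (d : ℕ) →
           IsGDD n Π 𝓑 → HasStrongDimension Π 𝓑 d →
           ∀ D → HasDimension (extendBlocks Π 𝓑) D → d ≤ D
lemma2p6 n Π 𝓑 d gdd (strongDim , _) D (_ , maximal) =
  maximal d (strongDimProp⇒dimProp gdd strongDim)
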